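{- Let $p$ be a prime, $m$ a positive integer and $G$ an extraspecial $p$-group of order $p^{2m+1}$. Then the intersection of all subgroups of $G$ of index smaller than $p^m$ is nontrivial.
   Context: A $p$-group $G$ is extraspecial if its center $Z(G)$ and its commutator subgroup $G'$ both have order $p$. -}

module Defs where

open import Data.Nat using (ℕ; zero; suc; _<_; _^_; _*_)
open import Data.Nat.DivMod using (_/_)
open import Data.Fin using (Fin)
open import Data.Fin.Subset using (Subset; _∈_; ∣_∣) public
open import Data.Product using (_×_; Σ; _,_)
open import Relation.Binary.PropositionalEquality using (_≡_)
open import Algebra.Structures using (IsGroup)
open import Function.Bundles using (_⇔_)

record FinGroup : Set where
  field
    order   : ℕ
    _∙_     : Fin order → Fin order → Fin order
    ε       : Fin order
    _⁻¹     : Fin order → Fin order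
    isGroup : IsGroup _≡_ _∙_ ε _⁻¹

module _ (G : FinGroup) where
  open FinGroup G

  record IsSubgroup (H : Subset order) : Set where
    field
      ε∈  : ε ∈ H
      ∙∈  : ∀ {x y} → x ∈ H → y ∈ H → (x ∙ y) ∈ H
      ⁻¹∈ : ∀ {x} → x ∈ H → (x ⁻¹) ∈ H

  -- truncated division (a ÷ 0 = 0); only used with positive divisors
  _÷_ : ℕ → ℕ → ℕ
  a ÷ zero  = 0
  a ÷ suc k = a / suc k

  -- index |G : H| = |G| / |H|  (Lagrange)
  index : Subset order → ℕ
  index H = order ÷ ∣ H ∣

  commutator : Fin order → Fin order → Fin order
  commutator x y = ((x ⁻¹) ∙ (y ⁻¹)) ∙ (x ∙ y)

  IsCenter : Subset order → Set
  IsCenter Z = ∀ x → (x ∈ Z) ⇔ (∀ y → (x ∙ y) ≡ (y ∙ x))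

  IsCommutatorSubgroup : Subset order → Set
  IsCommutatorSubgroup D =
    IsSubgroup D
    × (∀ x y → commutator x y ∈ D)
    × (∀ H → IsSubgroup H → (∀ x y → commutator x y ∈ H) → ∀ z → z ∈ D → z ∈ H)

  IsExtraspecial : ℕ → Set
  IsExtraspecial p =
    Σ ℕ (λ k → order ≡ p ^ k)
    × Σ (Subset order) (λ Z → IsCenter Z × ∣ Z ∣ ≡ p)
    × Σ (Subset order) (λ D → IsCommutatorSubgroup D × ∣ D ∣ ≡ p)

module Submission where

-- Let G be extraspecial of order p^(2m+1), with centre Z and commutator
-- subgroup G' both of order p.  The witness is any z ∈ Z ∖ {ε}: if z ∉ H then
-- H ∩ Z = 1.  G' is central (in a p-group a class inside G' ∖ {ε}, which has
-- fewer than p elements, is a singleton), so H' ⊆ H ∩ Z and H is abelian, and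
-- h ↦ [h, g] is a homomorphism into G'.  Hence centralisers of noncentral
-- elements have index p, and counting commuting pairs (h, g) ∈ H × G in two
-- ways gives |C(H)| · |H| = |G|.  As H ⊆ C(H), |H|² ≤ p^(2m+1), i.e. |G : H| ≥ p^m.

open import Defs
open import Data.Nat using (ℕ; zero; suc; pred; NonZero; ≢-nonZero⁻¹; nonTrivial⇒n>1; >-nonZero; _<_; _≤_; _^_; _+_; _*_; z≤n; s≤s)
open import Data.Nat.Properties hiding (_≟_)
open import Data.Nat.Divisibility using (_∣_; divides; ∣1⇒≡1; 0∣⇒≡0)
open import Data.Nat.DivMod using (_/_; m*n/n≡m; /-monoˡ-≤)
open import Data.Nat.Primality using (Prime; prime⇒nonZero; prime⇒nonTrivial; prime⇒irreducible)
open import Data.Nat.Coprimality using (coprime-divisor; prime⇒coprime) renaming (sym to coprime-sym)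
open import Data.Bool using (Bool; true; false; _∧_; not; if_then_else_)
open import Data.Bool.Properties using (¬-not; ∧-zeroʳ) renaming (_≟_ to _≟ᵇ_)
open import Data.Fin using (Fin) renaming (zero to fzero; suc to fsuc)
open import Data.Fin.Properties using (_≟_; any?; all?; ¬∀⟶∃¬)
open import Data.Fin.Subset using (Subset; _∈_)
open import Data.Fin.Permutation using (permutation)
open import Data.Maybe using (Maybe; just; nothing; fromMaybe)
import Data.Maybe as Maybe
open import Data.Vec using ([]; _∷_; lookup; tabulate)
open import Data.Vec.Properties using ([]=⇒lookup; lookup⇒[]=; lookup∘tabulate)
open import Data.Product using (Σ; ∃; _×_; _,_; proj₁; proj₂)
open import Data.Sum using (_⊎_; inj₁; inj₂)
open import Function using (_∘_)
open import Function.Bundles using (Equivalence)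
open import Relation.Nullary using (¬_; Dec; yes; no; does; _×-dec_; _→-dec_; contradiction)
open import Relation.Nullary.Decidable using (dec-true; dec-false)
open import Relation.Binary.PropositionalEquality hiding ([_])
open import Algebra.Structures using (IsGroup)
open import Algebra.Bundles using (Group)
import Algebra.Properties.Group as GroupProperties
import Algebra.Properties.Quasigroup as QuasigroupProperties
import Algebra.Solver.Monoid as MonoidSolver
open import Algebra.Properties.CommutativeMonoid.Sum +-0-commutativeMonoid
  using (sum; ∑-comm; ∑-distrib-+; sum-cong-≗; sum-permute)
open import Algebra.Properties.Semiring.Sum +-*-semiring using (*-distribˡ-sum; *-distribʳ-sum)

does-sound : ∀ {a} {A : Set a} (d : Dec A) → does d ≡ true → A
does-sound (yes a) _ = a

does-false : ∀ {a} {A : Set a} (d : Dec A) → does d ≡ false → ¬ A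
does-false (no ¬a) _ = ¬a

bool-ext : ∀ {a b : Bool} → (a ≡ true → b ≡ true) → (b ≡ true → a ≡ true) → a ≡ b
bool-ext {false} {false} _ _ = refl
bool-ext {false} {true}  _ g = g refl
bool-ext {true}  {false} f _ = sym (f refl)
bool-ext {true}  {true}  _ _ = refl

∧-true₁ : ∀ {a b} → a ∧ b ≡ true → a ≡ true
∧-true₁ {true} _ = refl

∧-true₂ : ∀ {a b} → a ∧ b ≡ true → b ≡ true
∧-true₂ {true} e = e

∧-intro : ∀ {a b} → a ≡ true → b ≡ true → a ∧ b ≡ true
∧-intro refl refl = refl

false≢true : false ≢ true
false≢true ()

_==_ : ∀ {n} → Fin n → Fin n → Bool
a == b = does (a ≟ b)

==-sound : ∀ {n} {a b : Fin n} → a == b ≡ true → a ≡ b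
==-sound {a = a} {b} = does-sound (a ≟ b)

==-refl : ∀ {n} (a : Fin n) → a == a ≡ true
==-refl a = dec-true (a ≟ a) refl

==-≢ : ∀ {n} {a b : Fin n} → a ≢ b → a == b ≡ false
==-≢ {a = a} {b} = dec-false (a ≟ b)

==-sym : ∀ {n} (a b : Fin n) → (a == b) ≡ (b == a)
==-sym a b = bool-ext (λ e → dec-true (b ≟ a) (sym (==-sound e))) (λ e → dec-true (a ≟ b) (sym (==-sound e)))

bit : Bool → ℕ
bit true  = 1
bit false = 0

count : ∀ {n} → (Fin n → Bool) → ℕ
count P = sum (λ i → bit (P i))

count-cong : ∀ {n} {P Q : Fin n → Bool} → (∀ i → P i ≡ Q i) → count P ≡ count Q
count-cong e = sum-cong-≗ (cong bit ∘ e)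

count-none : ∀ {n} (P : Fin n → Bool) → (∀ i → P i ≡ false) → count P ≡ 0
count-none {zero}  P e = refl
count-none {suc n} P e rewrite e fzero = count-none (P ∘ fsuc) (e ∘ fsuc)

count-full : ∀ {n} → count {n} (λ _ → true) ≡ n
count-full {zero}  = refl
count-full {suc n} = cong suc (count-full {n})

bit-mono : ∀ {a b} → (a ≡ true → b ≡ true) → bit a ≤ bit b
bit-mono {false} _ = z≤n
bit-mono {true}  h rewrite h refl = ≤-refl

count-mono : ∀ {n} (P Q : Fin n → Bool) → (∀ i → P i ≡ true → Q i ≡ true) → count P ≤ count Q
count-mono {zero}  P Q h = z≤n
count-mono {suc n} P Q h =
  +-mono-≤ (bit-mono (h fzero)) (count-mono (P ∘ fsuc) (Q ∘ fsuc) (h ∘ fsuc))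

count-⊆-eq : ∀ {n} (P Q : Fin n → Bool) → (∀ i → P i ≡ true → Q i ≡ true) → count Q ≤ count P
           → ∀ i → Q i ≡ true → P i ≡ true
count-⊆-eq {suc n} P Q P⊆Q Q≤P fzero Q₀ with P fzero | Q fzero
... | true  | _     = refl
... | false | false = contradiction Q₀ false≢true
... | false | true  = contradiction Q≤P (<⇒≱ (s≤s (count-mono (P ∘ fsuc) (Q ∘ fsuc) (P⊆Q ∘ fsuc))))
count-⊆-eq {suc n} P Q P⊆Q Q≤P (fsuc i) Qi =
  count-⊆-eq (P ∘ fsuc) (Q ∘ fsuc) (P⊆Q ∘ fsuc) tail-≤ i Qi
  where
  tail-≤ : count (Q ∘ fsuc) ≤ count (P ∘ fsuc)
  tail-≤ = +-cancelˡ-≤ (bit (Q fzero)) _ _ (≤-trans Q≤P (+-monoˡ-≤ _ (bit-mono (P⊆Q fzero))))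

count-split : ∀ {n} (P Q : Fin n → Bool) →
  count P ≡ count (λ i → P i ∧ Q i) + count (λ i → P i ∧ not (Q i))
count-split {zero}  P Q = refl
count-split {suc n} P Q with P fzero | Q fzero
... | false | _     = count-split (P ∘ fsuc) (Q ∘ fsuc)
... | true  | true  = cong suc (count-split (P ∘ fsuc) (Q ∘ fsuc))
... | true  | false = trans (cong suc (count-split (P ∘ fsuc) (Q ∘ fsuc)))
                           (sym (+-suc (count (λ i → P (fsuc i) ∧ Q (fsuc i))) _))

count-single : ∀ {n} (a : Fin n) → count (λ y → y == a) ≡ 1
count-single {suc n} fzero = cong suc (count-none {n} (λ i → fsuc i == fzero) (λ i → ==-≢ {a = fsuc i} {b = fzero} λ ()))
count-single {suc n} (fsuc a) =
  cong₂ _+_ (cong bit (==-≢ {a = fzero} {b = fsuc a} λ ())) (trans (count-cong shift) (count-single a))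
  where
  shift : ∀ i → (fsuc i == fsuc a) ≡ (i == a)
  shift i with i ≟ a
  ... | yes refl = refl
  ... | no _     = refl

count-pos : ∀ {n} (P : Fin n → Bool) a → P a ≡ true → 1 ≤ count P
count-pos P a Pa = ≤-trans (≤-reflexive (sym (count-single a)))
  (count-mono _ P (λ y y≡a → subst (λ x → P x ≡ true) (sym (==-sound y≡a)) Pa))

count-witness : ∀ {n} (P : Fin n → Bool) → 1 ≤ count P → ∃ λ a → P a ≡ true
count-witness P 1≤ with any? (λ a → P a ≟ᵇ true)
... | yes w  = w
... | no ¬w = contradiction (count-none P (λ a → ¬-not (λ Pa → ¬w (a , Pa)))) (λ e → <⇒≢ 1≤ (sym e))

count-at-a : ∀ {n} (P : Fin n → Bool) a → count (λ y → P y ∧ (y == a)) ≤ 1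
count-at-a P a = ≤-trans (count-mono _ _ (λ y → ∧-true₂ {P y})) (≤-reflexive (count-single a))

count-drop : ∀ {n} (P : Fin n → Bool) a → P a ≡ true → count (λ y → P y ∧ not (y == a)) < count P
count-drop P a Pa = ≤-trans (+-monoˡ-≤ _ (count-pos _ a (∧-intro Pa (==-refl a))))
                            (≤-reflexive (sym (count-split P (_== a))))

count-another : ∀ {n} (P : Fin n → Bool) → 2 ≤ count P → ∀ a → ∃ λ x → P x ≡ true × x ≢ a
count-another P 2≤ a with count-witness (λ y → P y ∧ not (y == a)) others-pos
  where
  others-pos : 1 ≤ count (λ y → P y ∧ not (y == a))
  others-pos = +-cancelˡ-≤ 1 _ _ (≤-trans 2≤ (≤-trans (≤-reflexive (count-split P (_== a)))
                                                     (+-monoˡ-≤ _ (count-at-a P a))))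
... | x , w = x , ∧-true₁ w , λ x≡a → false≢true (trans (cong not (sym (dec-true (x ≟ a) x≡a))) (∧-true₂ {P x} w))

count-≤1-unique : ∀ {n} (P : Fin n → Bool) → count P ≤ 1 → ∀ {a b} → P a ≡ true → P b ≡ true → a ≡ b
count-≤1-unique P ≤1 {a} {b} Pa Pb with a ≟ b
... | yes a≡b = a≡b
... | no a≢b = contradiction (≤-trans (+-mono-≤ (count-pos _ a (∧-intro Pa (==-refl a)))
                                                (count-pos _ b (∧-intro Pb (cong not (==-≢ (a≢b ∘ sym))))))
                                      (≤-trans (≤-reflexive (sym (count-split P (_== a)))) ≤1))
                             (λ { (s≤s ()) })

count-permute : ∀ {n} (P : Fin n → Bool) (σ τ : Fin n → Fin n) →
  (∀ x → σ (τ x) ≡ x) → (∀ x → τ (σ x) ≡ x) → count (P ∘ σ) ≡ count P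
count-permute P σ τ στ τσ = sym (sum-permute (bit ∘ P) (permutation σ τ στ τσ))

image : ∀ {n} → (Fin n → Bool) → (Fin n → Fin n) → Fin n → Bool
image K f y = does (any? λ x → (K x ≟ᵇ true) ×-dec (f x ≟ y))

image-intro : ∀ {n} (K : Fin n → Bool) f x → K x ≡ true → image K f (f x) ≡ true
image-intro K f x Kx = dec-true (any? _) (x , Kx , refl)

image-elim : ∀ {n} (K : Fin n → Bool) f y → image K f y ≡ true → ∃ λ x → K x ≡ true × f x ≡ y
image-elim K f y = does-sound (any? _)

count-fibres : ∀ {n} (K : Fin n → Bool) (f : Fin n → Fin n) c →
  (∀ k → K k ≡ true → count (λ x → K x ∧ (f x == f k)) ≡ c) →
  count K ≡ c * count (image K f)
count-fibres {n} K f c fibre = begin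
  count K                                        ≡⟨ sum-cong-≗ by-value ⟩
  sum (λ x → sum (λ y → bit (K x ∧ (f x == y)))) ≡⟨ ∑-comm (λ x y → bit (K x ∧ (f x == y))) ⟩
  sum (λ y → sum (λ x → bit (K x ∧ (f x == y)))) ≡⟨ sum-cong-≗ fibre-size ⟩
  sum (λ y → c * bit (image K f y))              ≡⟨ *-distribˡ-sum c (bit ∘ image K f) ⟨
  c * count (image K f)                          ∎
  where
  open ≡-Reasoning
  by-value : ∀ x → bit (K x) ≡ count (λ y → K x ∧ (f x == y))
  by-value x with K x
  ... | true  = trans (sym (count-single (f x))) (count-cong (λ y → ==-sym y (f x)))
  ... | false = sym (count-none {n} (λ _ → false) (λ _ → refl))
  fibre-size : ∀ y → count (λ x → K x ∧ (f x == y)) ≡ c * bit (image K f y)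
  fibre-size y with image K f y in e
  ... | true with image-elim K f y e
  ...   | k , Kk , refl = trans (fibre k Kk) (sym (*-identityʳ c))
  fibre-size y | false =
    trans (count-none _ (λ x → ¬-not (λ w → does-false (any? _) e (x , ∧-true₁ w , ==-sound (∧-true₂ {K x} w)))))
          (sym (*-zeroʳ c))

subset-count : ∀ {n} (S : Subset n) → ∣ S ∣ ≡ count (lookup S)
subset-count []          = refl
subset-count (true ∷ S)  = cong suc (subset-count S)
subset-count (false ∷ S) = subset-count S

sum-const : ∀ {n} c → sum {n} (λ _ → c) ≡ n * c
sum-const {zero}  c = refl
sum-const {suc n} c = cong (c +_) (sum-const {n} c)

count-scale : ∀ {n} (P : Fin n → Bool) c → sum (λ i → bit (P i) * c) ≡ count P * c
count-scale P c = sym (*-distribʳ-sum c (bit ∘ P))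

-- The first point satisfying a predicate, if any; it depends only on the
-- values of the predicate, which is what makes it a canonical choice.
first : ∀ {n} → (Fin n → Bool) → Maybe (Fin n)
first {zero}  P = nothing
first {suc n} P = if P fzero then just fzero else Maybe.map fsuc (first (P ∘ fsuc))

first-cong : ∀ {n} (P Q : Fin n → Bool) → (∀ i → P i ≡ Q i) → first P ≡ first Q
first-cong {zero}  P Q e = refl
first-cong {suc n} P Q e rewrite e fzero | first-cong (P ∘ fsuc) (Q ∘ fsuc) (e ∘ fsuc) = refl

first-sound : ∀ {n} (P : Fin n → Bool) {j} → first P ≡ just j → P j ≡ true
first-sound {suc n} P e with P fzero in P₀
first-sound {suc n} P refl | true = P₀
... | false with first (P ∘ fsuc) in e′
first-sound {suc n} P refl | false | just k = first-sound (P ∘ fsuc) e′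

first-complete : ∀ {n} (P : Fin n → Bool) i → P i ≡ true → ∃ λ j → first P ≡ just j
first-complete {suc n} P i Pi with P fzero in P₀
... | true = fzero , refl
first-complete {suc n} P fzero Pi | false = contradiction (trans (sym Pi) P₀) λ ()
first-complete {suc n} P (fsuc i) Pi | false with first-complete (P ∘ fsuc) i Pi
... | j , e rewrite e = fsuc j , refl

small-divisor-of-prime-power : ∀ {p} → Prime p → ∀ k a → a ∣ p ^ k → a < p → a ≡ 1
small-divisor-of-prime-power pr zero a a∣ _ = ∣1⇒≡1 a∣
small-divisor-of-prime-power {p} pr (suc k) zero a∣ _ = contradiction (0∣⇒≡0 a∣) (≢-nonZero⁻¹ (p ^ suc k) {{m^n≢0 p (suc k)}})
  where instance _ = prime⇒nonZero pr
small-divisor-of-prime-power pr (suc k) (suc a) a∣ a<p =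
  small-divisor-of-prime-power pr k (suc a) (coprime-divisor (coprime-sym (prime⇒coprime pr a<p)) a∣) a<p

-- Elementary group theory in a finite group carried by Fin n.
module GroupTheory (G : FinGroup) where

  open FinGroup G renaming (_∙_ to infixl 7 _∙_; _⁻¹ to infix 8 _⁻¹)
  open IsGroup isGroup using (assoc; identityˡ; identityʳ; inverseˡ; inverseʳ)

  group : Group _ _
  group = record { Carrier = Fin order ; _≈_ = _≡_ ; _∙_ = _∙_ ; ε = ε ; _⁻¹ = _⁻¹ ; isGroup = isGroup }

  open GroupProperties group
    using (⁻¹-involutive; ⁻¹-anti-homo-∙; inverseʳ-unique; ε⁻¹≈ε; quasigroup;
           \\-leftDividesˡ; \\-leftDividesʳ; //-rightDividesˡ; //-rightDividesʳ)
  open QuasigroupProperties quasigroup using (cancelˡ)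
  open MonoidSolver (Group.monoid group) using (solve; _⊜_; _⊕_)

  [_,_] : Fin order → Fin order → Fin order
  [_,_] = commutator G

  commutator-trivial⇒commute : ∀ x y → [ x , y ] ≡ ε → x ∙ y ≡ y ∙ x
  commutator-trivial⇒commute x y e = trans (inverseʳ-unique _ _ e)
    (trans (⁻¹-anti-homo-∙ _ _) (cong₂ _∙_ (⁻¹-involutive y) (⁻¹-involutive x)))

  commute⇒commutator-trivial : ∀ x y → x ∙ y ≡ y ∙ x → [ x , y ] ≡ ε
  commute⇒commutator-trivial x y e = trans (cong ((x ⁻¹ ∙ y ⁻¹) ∙_) e)
    (trans (assoc _ _ _) (trans (cong (x ⁻¹ ∙_) (\\-leftDividesʳ y x)) (inverseˡ x)))

  commutes : Fin order → Fin order → Bool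
  commutes x y = [ x , y ] == ε

  commutes-sym : ∀ x y → commutes x y ≡ commutes y x
  commutes-sym x y = bool-ext (flipped x y) (flipped y x)
    where
    flipped : ∀ a b → commutes a b ≡ true → commutes b a ≡ true
    flipped a b e = dec-true ([ b , a ] ≟ ε)
      (commute⇒commutator-trivial b a (sym (commutator-trivial⇒commute a b (==-sound e))))

  commutes-ε : ∀ g → commutes ε g ≡ true
  commutes-ε g = dec-true ([ ε , g ] ≟ ε)
    (commute⇒commutator-trivial ε g (trans (identityˡ g) (sym (identityʳ g))))

  conj : Fin order → Fin order → Fin order
  conj g x = (g ∙ x) ∙ g ⁻¹

  conj-∙ : ∀ g x y → conj g (x ∙ y) ≡ conj g x ∙ conj g y
  conj-∙ g x y = sym (begin
    ((g ∙ x) ∙ g ⁻¹) ∙ ((g ∙ y) ∙ g ⁻¹)  ≡⟨ solve 4 (λ g x g′ y → ((g ⊕ x) ⊕ g′) ⊕ ((g ⊕ y) ⊕ g′)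
                                                ⊜ (g ⊕ x) ⊕ ((g′ ⊕ g) ⊕ (y ⊕ g′))) refl g x (g ⁻¹) y ⟩
    (g ∙ x) ∙ ((g ⁻¹ ∙ g) ∙ (y ∙ g ⁻¹)) ≡⟨ cong (λ t → (g ∙ x) ∙ (t ∙ (y ∙ g ⁻¹))) (inverseˡ g) ⟩
    (g ∙ x) ∙ (ε ∙ (y ∙ g ⁻¹))           ≡⟨ cong ((g ∙ x) ∙_) (identityˡ _) ⟩
    (g ∙ x) ∙ (y ∙ g ⁻¹)                 ≡⟨ solve 4 (λ g x g′ y → (g ⊕ x) ⊕ (y ⊕ g′) ⊜ (g ⊕ (x ⊕ y)) ⊕ g′)
                                                refl g x (g ⁻¹) y ⟩
    (g ∙ (x ∙ y)) ∙ g ⁻¹                 ∎)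
    where open ≡-Reasoning

  conj-ε : ∀ g → conj g ε ≡ ε
  conj-ε g = trans (cong (_∙ g ⁻¹) (identityʳ g)) (inverseʳ g)

  conj-⁻¹ : ∀ g x → conj g (x ⁻¹) ≡ conj g x ⁻¹
  conj-⁻¹ g x = inverseʳ-unique _ _ (trans (sym (conj-∙ g x (x ⁻¹)))
                                           (trans (cong (conj g) (inverseʳ x)) (conj-ε g)))

  conj-action : ∀ a b x → conj a (conj b x) ≡ conj (a ∙ b) x
  conj-action a b x = begin
    (a ∙ ((b ∙ x) ∙ b ⁻¹)) ∙ a ⁻¹   ≡⟨ solve 5 (λ a b x b′ a′ → (a ⊕ ((b ⊕ x) ⊕ b′)) ⊕ a′
                                           ⊜ ((a ⊕ b) ⊕ x) ⊕ (b′ ⊕ a′)) refl a b x (b ⁻¹) (a ⁻¹) ⟩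
    ((a ∙ b) ∙ x) ∙ (b ⁻¹ ∙ a ⁻¹)   ≡⟨ cong (((a ∙ b) ∙ x) ∙_) (⁻¹-anti-homo-∙ a b) ⟨
    ((a ∙ b) ∙ x) ∙ (a ∙ b) ⁻¹      ∎
    where open ≡-Reasoning

  conj-identity : ∀ x → conj ε x ≡ x
  conj-identity x = trans (cong₂ _∙_ (identityˡ x) ε⁻¹≈ε) (identityʳ x)

  conj-injective : ∀ g {x y} → conj g x ≡ conj g y → x ≡ y
  conj-injective g {x} {y} e = trans (sym (undo x)) (trans (cong (conj (g ⁻¹)) e) (undo y))
    where
    undo : ∀ z → conj (g ⁻¹) (conj g z) ≡ z
    undo z = trans (conj-action _ _ _) (trans (cong (λ t → conj t z) (inverseˡ g)) (conj-identity z))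

  conj-commutator : ∀ g x y → conj g [ x , y ] ≡ [ conj g x , conj g y ]
  conj-commutator g x y = trans (conj-∙ g _ _) (cong₂ _∙_
    (trans (conj-∙ g _ _) (cong₂ _∙_ (conj-⁻¹ g x) (conj-⁻¹ g y)))
    (conj-∙ g x y))

  conj-fixed⇒commute : ∀ g x → conj g x ≡ x → g ∙ x ≡ x ∙ g
  conj-fixed⇒commute g x e = trans (sym (//-rightDividesˡ g (g ∙ x))) (cong (_∙ g) e)

  hom-ε : ∀ (f : Fin order → Fin order) → (∀ x y → f (x ∙ y) ≡ f x ∙ f y) → f ε ≡ ε
  hom-ε f hom = cancelˡ (f ε) _ _
    (trans (sym (hom ε ε)) (trans (cong f (identityˡ ε)) (sym (identityʳ (f ε)))))

  hom-⁻¹ : ∀ (f : Fin order → Fin order) → (∀ x y → f (x ∙ y) ≡ f x ∙ f y) → ∀ x → f (x ⁻¹) ≡ f x ⁻¹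
  hom-⁻¹ f hom x = inverseʳ-unique _ _
    (trans (sym (hom x (x ⁻¹))) (trans (cong f (inverseʳ x)) (hom-ε f hom)))

  record IsSubgroupᵇ (P : Fin order → Bool) : Set where
    field
      ε∈  : P ε ≡ true
      ∙∈  : ∀ {x y} → P x ≡ true → P y ≡ true → P (x ∙ y) ≡ true
      ⁻¹∈ : ∀ {x} → P x ≡ true → P (x ⁻¹) ≡ true
  open IsSubgroupᵇ public

  subgroupᵇ : ∀ {S : Subset order} → IsSubgroup G S → IsSubgroupᵇ (lookup S)
  subgroupᵇ {S} isS = record
    { ε∈  = []=⇒lookup (IsSubgroup.ε∈ isS)
    ; ∙∈  = λ Px Py → []=⇒lookup (IsSubgroup.∙∈ isS (lookup⇒[]= _ S Px) (lookup⇒[]= _ S Py))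
    ; ⁻¹∈ = λ Px → []=⇒lookup (IsSubgroup.⁻¹∈ isS (lookup⇒[]= _ S Px)) }

  whole-subgroup : IsSubgroupᵇ (λ _ → true)
  whole-subgroup = record { ε∈ = refl ; ∙∈ = λ _ _ → refl ; ⁻¹∈ = λ _ → refl }

  ∩-subgroup : ∀ {A B} → IsSubgroupᵇ A → IsSubgroupᵇ B → IsSubgroupᵇ (λ x → A x ∧ B x)
  ∩-subgroup {A} {B} sA sB = record
    { ε∈  = ∧-intro (ε∈ sA) (ε∈ sB)
    ; ∙∈  = λ {x} {y} ABx ABy → ∧-intro (∙∈ sA (∧-true₁ ABx) (∧-true₁ ABy))
                                         (∙∈ sB (∧-true₂ {A x} ABx) (∧-true₂ {A y} ABy))
    ; ⁻¹∈ = λ {x} ABx → ∧-intro (⁻¹∈ sA (∧-true₁ ABx)) (⁻¹∈ sB (∧-true₂ {A x} ABx)) }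

  image-subgroup : ∀ {K} → IsSubgroupᵇ K → (f : Fin order → Fin order) →
    (∀ x y → f (x ∙ y) ≡ f x ∙ f y) → IsSubgroupᵇ (image K f)
  image-subgroup {K} sK f hom = record
    { ε∈  = subst (λ t → image K f t ≡ true) (hom-ε f hom) (image-intro K f ε (ε∈ sK))
    ; ∙∈  = λ {a} {b} Ia Ib → closed-∙ (image-elim K f a Ia) (image-elim K f b Ib)
    ; ⁻¹∈ = λ {a} Ia → closed-⁻¹ (image-elim K f a Ia) }
    where
    closed-∙ : ∀ {a b} → ∃ (λ x → K x ≡ true × f x ≡ a) → ∃ (λ y → K y ≡ true × f y ≡ b) →
      image K f (a ∙ b) ≡ true
    closed-∙ (x , Kx , refl) (y , Ky , refl) =
      subst (λ t → image K f t ≡ true) (hom x y) (image-intro K f (x ∙ y) (∙∈ sK Kx Ky))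
    closed-⁻¹ : ∀ {a} → ∃ (λ x → K x ≡ true × f x ≡ a) → image K f (a ⁻¹) ≡ true
    closed-⁻¹ (x , Kx , refl) =
      subst (λ t → image K f t ≡ true) (hom-⁻¹ f hom x) (image-intro K f (x ⁻¹) (⁻¹∈ sK Kx))

  -- Left cosets: x ∈ kL ⇔ k ∈ xL.
  coset-sym : ∀ {L} → IsSubgroupᵇ L → ∀ {a b} → L (a ⁻¹ ∙ b) ≡ true → L (b ⁻¹ ∙ a) ≡ true
  coset-sym {L} sL {a} {b} e = subst (λ t → L t ≡ true) inverse (⁻¹∈ sL e)
    where
    inverse : (a ⁻¹ ∙ b) ⁻¹ ≡ b ⁻¹ ∙ a
    inverse = trans (⁻¹-anti-homo-∙ _ _) (cong (b ⁻¹ ∙_) (⁻¹-involutive a))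

  coset-trans : ∀ {L} → IsSubgroupᵇ L → ∀ {a b c} → L (a ⁻¹ ∙ b) ≡ true → L (b ⁻¹ ∙ c) ≡ true →
    L (a ⁻¹ ∙ c) ≡ true
  coset-trans {L} sL {a} {b} {c} ab bc =
    subst (λ t → L t ≡ true) (trans (assoc _ _ _) (cong (a ⁻¹ ∙_) (\\-leftDividesˡ b c))) (∙∈ sL ab bc)

  count-translate : ∀ (R : Fin order → Bool) g → count (λ x → R (g ∙ x)) ≡ count R
  count-translate R g = count-permute R (g ∙_) (g ⁻¹ ∙_) (\\-leftDividesˡ g) (\\-leftDividesʳ g)

  count-coset-fibres : ∀ {K} → IsSubgroupᵇ K → (f : Fin order → Fin order) (T : Fin order → Bool) →
    (∀ k x → K k ≡ true → K x ≡ true → (f x == f k) ≡ T (k ⁻¹ ∙ x)) →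
    count K ≡ count (λ y → K y ∧ T y) * count (image K f)
  count-coset-fibres {K} sK f T same-fibre = count-fibres K f _ fibre
    where
    fibre : ∀ k → K k ≡ true → count (λ x → K x ∧ (f x == f k)) ≡ count (λ y → K y ∧ T y)
    fibre k Kk = begin
      count (λ x → K x ∧ (f x == f k))           ≡⟨ count-cong as-coset ⟩
      count (λ x → K x ∧ T (k ⁻¹ ∙ x))           ≡⟨ count-translate (λ x → K x ∧ T (k ⁻¹ ∙ x)) k ⟨
      count (λ y → K (k ∙ y) ∧ T (k ⁻¹ ∙ (k ∙ y))) ≡⟨ count-cong translated ⟩
      count (λ y → K y ∧ T y)                     ∎
      where
      open ≡-Reasoning
      as-coset : ∀ x → (K x ∧ (f x == f k)) ≡ (K x ∧ T (k ⁻¹ ∙ x))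
      as-coset x with K x in Kx
      ... | true  = same-fibre k x Kk Kx
      ... | false = refl
      K-translate : ∀ y → K (k ∙ y) ≡ K y
      K-translate y = bool-ext (λ Kky → subst (λ t → K t ≡ true) (\\-leftDividesʳ k y) (∙∈ sK (⁻¹∈ sK Kk) Kky))
                               (∙∈ sK Kk)
      translated : ∀ y → (K (k ∙ y) ∧ T (k ⁻¹ ∙ (k ∙ y))) ≡ (K y ∧ T y)
      translated y = cong₂ _∧_ (K-translate y) (cong T (\\-leftDividesʳ k y))

  count-kernel-image : ∀ {K} → IsSubgroupᵇ K → (f : Fin order → Fin order) →
    (∀ x y → f (x ∙ y) ≡ f x ∙ f y) →
    count K ≡ count (λ y → K y ∧ (f y == ε)) * count (image K f)
  count-kernel-image {K} sK f hom = count-coset-fibres sK f (λ y → f y == ε) same-fibre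
    where
    split : ∀ k x → f x ≡ f k ∙ f (k ⁻¹ ∙ x)
    split k x = trans (cong f (sym (\\-leftDividesˡ k x))) (hom k (k ⁻¹ ∙ x))
    same-fibre : ∀ k x → K k ≡ true → K x ≡ true → (f x == f k) ≡ (f (k ⁻¹ ∙ x) == ε)
    same-fibre k x _ _ = bool-ext
      (λ e → dec-true (_ ≟ ε) (cancelˡ (f k) _ _
        (trans (sym (split k x)) (trans (==-sound e) (sym (identityʳ (f k)))))))
      (λ e → dec-true (_ ≟ f k) (trans (split k x)
        (trans (cong (f k ∙_) (==-sound e)) (identityʳ (f k)))))

  lagrange : ∀ {K L} → IsSubgroupᵇ K → IsSubgroupᵇ L → (∀ x → L x ≡ true → K x ≡ true) →
    count L ∣ count K
  lagrange {K} {L} sK sL L⊆K =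
    divides (count (image K rep)) (trans counted (*-comm (count L) _))
    where
    -- the canonical representative of the left coset xL is its first element
    rep : Fin order → Fin order
    rep x = fromMaybe x (first (λ y → L (x ⁻¹ ∙ y)))

    x∈xL : ∀ x → L (x ⁻¹ ∙ x) ≡ true
    x∈xL x = subst (λ t → L t ≡ true) (sym (inverseˡ x)) (ε∈ sL)

    rep-in-coset : ∀ x → L (x ⁻¹ ∙ rep x) ≡ true
    rep-in-coset x with first (λ y → L (x ⁻¹ ∙ y)) in e
    ... | just j  = first-sound _ e
    ... | nothing = contradiction (trans (sym e) (proj₂ (first-complete _ x (x∈xL x)))) λ ()

    rep-of-coset : ∀ k x → L (k ⁻¹ ∙ x) ≡ true → rep x ≡ rep k
    rep-of-coset k x kx =
      trans (cong (fromMaybe x) (first-cong _ _ same-coset)) (from-just (first-complete _ k (x∈xL k)))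
      where
      same-coset : ∀ y → L (x ⁻¹ ∙ y) ≡ L (k ⁻¹ ∙ y)
      same-coset y = bool-ext (coset-trans sL kx) (coset-trans sL (coset-sym sL kx))
      from-just : ∀ {m} → ∃ (λ j → m ≡ just j) → fromMaybe x m ≡ fromMaybe k m
      from-just (j , refl) = refl

    same-fibre : ∀ k x → K k ≡ true → K x ≡ true → (rep x == rep k) ≡ L (k ⁻¹ ∙ x)
    same-fibre k x _ _ = bool-ext
      (λ e → coset-trans sL (rep-in-coset k)
        (subst (λ t → L (t ⁻¹ ∙ x) ≡ true) (==-sound e) (coset-sym sL (rep-in-coset x))))
      (λ kx → dec-true (rep x ≟ rep k) (rep-of-coset k x kx))

    K∩L≡L : ∀ y → (K y ∧ L y) ≡ L y
    K∩L≡L y with L y in Ly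
    ... | true  = cong (_∧ true) (L⊆K y Ly)
    ... | false = ∧-zeroʳ (K y)

    counted : count K ≡ count L * count (image K rep)
    counted = trans (count-coset-fibres sK rep L same-fibre)
                    (cong (_* count (image K rep)) (count-cong K∩L≡L))

  subgroup-of-prime-order : ∀ {p K L} → Prime p → IsSubgroupᵇ K → IsSubgroupᵇ L →
    (∀ x → L x ≡ true → K x ≡ true) → count K ≡ p →
    (∀ x → L x ≡ true → x ≡ ε) ⊎ count L ≡ p
  subgroup-of-prime-order {L = L} pr sK sL L⊆K |K|≡p
    with prime⇒irreducible pr (subst (count L ∣_) |K|≡p (lagrange sK sL L⊆K))
  ... | inj₂ |L|≡p = inj₂ |L|≡p
  ... | inj₁ |L|≡1 = inj₁ (λ x Lx → count-≤1-unique L (≤-reflexive |L|≡1) Lx (ε∈ sL))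

  conjugacy-class : Fin order → Fin order → Bool
  conjugacy-class d = image (λ _ → true) (λ g → conj g d)

  orbit-stabiliser : ∀ d → order ≡ count (λ g → conj g d == d) * count (conjugacy-class d)
  orbit-stabiliser d = trans (sym count-full)
    (count-coset-fibres whole-subgroup (λ g → conj g d) (λ g → conj g d == d) same-fibre)
    where
    split : ∀ k x → conj x d ≡ conj k (conj (k ⁻¹ ∙ x) d)
    split k x = trans (cong (λ t → conj t d) (sym (\\-leftDividesˡ k x))) (sym (conj-action k _ d))
    same-fibre : ∀ k x → true ≡ true → true ≡ true → (conj x d == conj k d) ≡ (conj (k ⁻¹ ∙ x) d == d)
    same-fibre k x _ _ = bool-ext
      (λ e → dec-true (_ ≟ d) (conj-injective k (trans (sym (split k x)) (==-sound e))))
      (λ e → dec-true (_ ≟ conj k d) (trans (split k x) (cong (conj k) (==-sound e))))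

  small-class⇒central : ∀ {p k} → Prime p → order ≡ p ^ k →
    ∀ d → count (conjugacy-class d) < p → ∀ g → g ∙ d ≡ d ∙ g
  small-class⇒central {p} {k} pr |G| d small g =
    conj-fixed⇒commute g d (count-≤1-unique _ (≤-reflexive class-size) (conjugate g) d-in-class)
    where
    conjugate : ∀ h → conjugacy-class d (conj h d) ≡ true
    conjugate h = image-intro _ (λ h → conj h d) h refl
    d-in-class : conjugacy-class d d ≡ true
    d-in-class = subst (λ t → conjugacy-class d t ≡ true) (conj-identity d) (conjugate ε)
    class-size : count (conjugacy-class d) ≡ 1
    class-size = small-divisor-of-prime-power pr k _
      (divides (count (λ h → conj h d == d)) (trans (sym |G|) (orbit-stabiliser d))) small

  module Centre {Z : Subset order} (isZ : IsCenter G Z) where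

    central⇒∈ : ∀ {x} → (∀ y → x ∙ y ≡ y ∙ x) → lookup Z x ≡ true
    central⇒∈ {x} c = []=⇒lookup (Equivalence.from (isZ x) c)

    ∈⇒central : ∀ {x} → lookup Z x ≡ true → ∀ y → x ∙ y ≡ y ∙ x
    ∈⇒central {x} Zx = Equivalence.to (isZ x) (lookup⇒[]= x Z Zx)

    noncentral-witness : ∀ x → lookup Z x ≡ false → ∃ λ y → x ∙ y ≢ y ∙ x
    noncentral-witness x Zx≡false = ¬∀⟶∃¬ order _ (λ y → x ∙ y ≟ y ∙ x)
      (λ c → false≢true (trans (sym Zx≡false) (central⇒∈ c)))

    centre-subgroup : IsSubgroupᵇ (lookup Z)
    centre-subgroup = record
      { ε∈  = central⇒∈ (λ y → trans (identityˡ y) (sym (identityʳ y)))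
      ; ∙∈  = λ Za Zb → central⇒∈ (product-central (∈⇒central Za) (∈⇒central Zb))
      ; ⁻¹∈ = λ Za → central⇒∈ (inverse-central (∈⇒central Za)) }
      where
      open ≡-Reasoning
      product-central : ∀ {a b} → (∀ y → a ∙ y ≡ y ∙ a) → (∀ y → b ∙ y ≡ y ∙ b) →
        ∀ y → (a ∙ b) ∙ y ≡ y ∙ (a ∙ b)
      product-central {a} {b} ca cb y = begin
        (a ∙ b) ∙ y ≡⟨ assoc a b y ⟩
        a ∙ (b ∙ y) ≡⟨ cong (a ∙_) (cb y) ⟩
        a ∙ (y ∙ b) ≡⟨ assoc a y b ⟨
        (a ∙ y) ∙ b ≡⟨ cong (_∙ b) (ca y) ⟩
        (y ∙ a) ∙ b ≡⟨ assoc y a b ⟩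
        y ∙ (a ∙ b) ∎
      inverse-central : ∀ {a} → (∀ y → a ∙ y ≡ y ∙ a) → ∀ y → a ⁻¹ ∙ y ≡ y ∙ a ⁻¹
      inverse-central {a} ca y = begin
        a ⁻¹ ∙ y                 ≡⟨ //-rightDividesʳ a (a ⁻¹ ∙ y) ⟨
        ((a ⁻¹ ∙ y) ∙ a) ∙ a ⁻¹ ≡⟨ cong (_∙ a ⁻¹) (assoc _ _ _) ⟩
        (a ⁻¹ ∙ (y ∙ a)) ∙ a ⁻¹ ≡⟨ cong (λ t → (a ⁻¹ ∙ t) ∙ a ⁻¹) (ca y) ⟨
        (a ⁻¹ ∙ (a ∙ y)) ∙ a ⁻¹ ≡⟨ cong (_∙ a ⁻¹) (\\-leftDividesʳ a y) ⟩
        y ∙ a ⁻¹                 ∎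

  module CommutatorSubgroup {D : Subset order} (isD : IsCommutatorSubgroup G D) where

    commutator-subgroup : IsSubgroupᵇ (lookup D)
    commutator-subgroup = subgroupᵇ (proj₁ isD)

    commutator∈ : ∀ a b → lookup D [ a , b ] ≡ true
    commutator∈ a b = []=⇒lookup (proj₁ (proj₂ isD) a b)

    -- G' is normal: its conjugate by g is a subgroup containing all commutators.
    conj∈ : ∀ g {d} → lookup D d ≡ true → lookup D (conj g d) ≡ true
    conj∈ g {d} Dd = trans (sym (lookup∘tabulate _ d))
      ([]=⇒lookup (proj₂ (proj₂ isD) conjugated conjugated-subgroup conjugated-commutator d (lookup⇒[]= d D Dd)))
      where
      conjugated : Subset order
      conjugated = tabulate (λ x → lookup D (conj g x))
      into : ∀ {x} → lookup D (conj g x) ≡ true → x ∈ conjugated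
      into {x} e = lookup⇒[]= x conjugated (trans (lookup∘tabulate _ x) e)
      from : ∀ {x} → x ∈ conjugated → lookup D (conj g x) ≡ true
      from {x} e = trans (sym (lookup∘tabulate _ x)) ([]=⇒lookup e)
      sD : IsSubgroupᵇ (lookup D)
      sD = commutator-subgroup
      conjugated-subgroup : IsSubgroup G conjugated
      conjugated-subgroup = record
        { ε∈  = into (subst (λ t → lookup D t ≡ true) (sym (conj-ε g)) (ε∈ sD))
        ; ∙∈  = λ {x} {y} ex ey → into (subst (λ t → lookup D t ≡ true) (sym (conj-∙ g x y))
                                                (∙∈ sD (from ex) (from ey)))
        ; ⁻¹∈ = λ {x} ex → into (subst (λ t → lookup D t ≡ true) (sym (conj-⁻¹ g x)) (⁻¹∈ sD (from ex))) }
      conjugated-commutator : ∀ x y → [ x , y ] ∈ conjugated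
      conjugated-commutator x y =
        into (subst (λ t → lookup D t ≡ true) (sym (conj-commutator g x y)) (commutator∈ _ _))

  commutator-∙ˡ : (∀ a b z → [ a , b ] ∙ z ≡ z ∙ [ a , b ]) → ∀ x y g → [ x ∙ y , g ] ≡ [ x , g ] ∙ [ y , g ]
  commutator-∙ˡ central x y g = begin
    ((x ∙ y) ⁻¹ ∙ g ⁻¹) ∙ ((x ∙ y) ∙ g)       ≡⟨ cong (λ t → (t ∙ g ⁻¹) ∙ ((x ∙ y) ∙ g)) (⁻¹-anti-homo-∙ x y) ⟩
    ((y ⁻¹ ∙ x ⁻¹) ∙ g ⁻¹) ∙ ((x ∙ y) ∙ g)    ≡⟨ solve 6 (λ y′ x′ g′ x y g → ((y′ ⊕ x′) ⊕ g′) ⊕ ((x ⊕ y) ⊕ g)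
                                                     ⊜ y′ ⊕ (((x′ ⊕ g′) ⊕ x) ⊕ (y ⊕ g))) refl (y ⁻¹) (x ⁻¹) (g ⁻¹) x y g ⟩
    y ⁻¹ ∙ (((x ⁻¹ ∙ g ⁻¹) ∙ x) ∙ (y ∙ g))    ≡⟨ cong (λ t → y ⁻¹ ∙ (t ∙ (y ∙ g))) rearranged ⟩
    y ⁻¹ ∙ ((c ∙ g ⁻¹) ∙ (y ∙ g))             ≡⟨ solve 5 (λ y′ c g′ y g → y′ ⊕ ((c ⊕ g′) ⊕ (y ⊕ g))
                                                     ⊜ (y′ ⊕ c) ⊕ (g′ ⊕ (y ⊕ g))) refl (y ⁻¹) c (g ⁻¹) y g ⟩
    (y ⁻¹ ∙ c) ∙ (g ⁻¹ ∙ (y ∙ g))             ≡⟨ cong (_∙ (g ⁻¹ ∙ (y ∙ g))) (central x g (y ⁻¹)) ⟨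
    (c ∙ y ⁻¹) ∙ (g ⁻¹ ∙ (y ∙ g))             ≡⟨ solve 5 (λ c y′ g′ y g → (c ⊕ y′) ⊕ (g′ ⊕ (y ⊕ g))
                                                     ⊜ c ⊕ ((y′ ⊕ g′) ⊕ (y ⊕ g))) refl c (y ⁻¹) (g ⁻¹) y g ⟩
    c ∙ ((y ⁻¹ ∙ g ⁻¹) ∙ (y ∙ g))             ∎
    where
    open ≡-Reasoning
    c : Fin order
    c = [ x , g ]
    rearranged : (x ⁻¹ ∙ g ⁻¹) ∙ x ≡ c ∙ g ⁻¹
    rearranged = sym (trans
      (solve 4 (λ x′ g′ x g → ((x′ ⊕ g′) ⊕ (x ⊕ g)) ⊕ g′ ⊜ ((x′ ⊕ g′) ⊕ x) ⊕ (g ⊕ g′)) refl (x ⁻¹) (g ⁻¹) x g)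
      (trans (cong (((x ⁻¹ ∙ g ⁻¹) ∙ x) ∙_) (inverseʳ g)) (identityʳ _)))

¬-implication : ∀ {a b} {A : Set a} {B : Set b} → Dec A → ¬ (A → B) → A × ¬ B
¬-implication (yes a) ¬a→b = a , λ b → ¬a→b (λ _ → b)
¬-implication (no ¬a) ¬a→b = contradiction (λ a → contradiction a ¬a) ¬a→b

module Extraspecial (G : FinGroup) {p} (pr : Prime p) {k} (|G| : FinGroup.order G ≡ p ^ k)
  {Z : Subset (FinGroup.order G)} (isZ : IsCenter G Z) (|Z| : ∣ Z ∣ ≡ p)
  {D : Subset (FinGroup.order G)} (isD : IsCommutatorSubgroup G D) (|D| : ∣ D ∣ ≡ p) where

  open FinGroup G renaming (_∙_ to infixl 7 _∙_; _⁻¹ to infix 8 _⁻¹)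
  open GroupTheory G
  open Centre isZ
  open CommutatorSubgroup isD

  Zᵇ Dᵇ : Fin order → Bool
  Zᵇ = lookup Z
  Dᵇ = lookup D

  count-Z : count Zᵇ ≡ p
  count-Z = trans (sym (subset-count Z)) |Z|

  count-D : count Dᵇ ≡ p
  count-D = trans (sym (subset-count D)) |D|

  -- G' is central: a nontrivial d ∈ G' has all its conjugates in G' ∖ {ε},
  -- fewer than p elements, so its class is a singleton.
  commutators-central : ∀ a b z → [ a , b ] ∙ z ≡ z ∙ [ a , b ]
  commutators-central a b z with [ a , b ] ≟ ε
  ... | yes d≡ε = ∈⇒central (subst (λ t → Zᵇ t ≡ true) (sym d≡ε) (ε∈ centre-subgroup)) z
  ... | no d≢ε = sym (small-class⇒central {k = k} pr |G| [ a , b ] small-class z)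
    where
    d : Fin order
    d = [ a , b ]
    class⊆D∖ε : ∀ y → conjugacy-class d y ≡ true → (Dᵇ y ∧ not (y == ε)) ≡ true
    class⊆D∖ε y e with image-elim _ (λ g → conj g d) y e
    ... | g , _ , refl = ∧-intro (conj∈ g (commutator∈ a b))
      (cong not (==-≢ λ e → d≢ε (conj-injective g (trans e (sym (conj-ε g))))))
    small-class : count (conjugacy-class d) < p
    small-class = ≤-<-trans (count-mono _ _ class⊆D∖ε)
      (subst (count (λ y → Dᵇ y ∧ not (y == ε)) <_) count-D (count-drop Dᵇ ε (ε∈ commutator-subgroup)))

  -- Hence h ↦ [h, g] is a homomorphism into G'; if it is nontrivial on a
  -- subgroup K, its image is all of G' and the centraliser of g in K has index p.
  centraliser-index : ∀ {K} → IsSubgroupᵇ K → ∀ g x → K x ≡ true → [ x , g ] ≢ ε →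
    count K ≡ count (λ y → K y ∧ commutes y g) * p
  centraliser-index {K} sK g x Kx nontrivial =
    trans (count-kernel-image sK (λ y → [ y , g ]) hom) (cong (count (λ y → K y ∧ commutes y g) *_) image-size)
    where
    hom : ∀ u v → [ u ∙ v , g ] ≡ [ u , g ] ∙ [ v , g ]
    hom u v = commutator-∙ˡ commutators-central u v g
    image⊆D : ∀ y → image K (λ y → [ y , g ]) y ≡ true → Dᵇ y ≡ true
    image⊆D y e with image-elim K _ y e
    ... | u , _ , refl = commutator∈ u g
    image-size : count (image K (λ y → [ y , g ])) ≡ p
    image-size with subgroup-of-prime-order pr commutator-subgroup (image-subgroup sK _ hom) image⊆D count-D
    ... | inj₂ size = size
    ... | inj₁ trivial = contradiction (trivial _ (image-intro K _ x Kx)) nontrivial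

  -- Write p = 1 + q; the double count below yields q·|C(H)|·|H| = q·|G|, with q ≥ 1.
  q : ℕ
  q = pred p

  p≡1+q : p ≡ suc q
  p≡1+q = sym (suc-pred p {{prime⇒nonZero pr}})

  1≤q : 1 ≤ q
  1≤q = pred-mono-≤ (nonTrivial⇒n>1 p {{prime⇒nonTrivial pr}})

  module CoreFree {H : Fin order → Bool} (sH : IsSubgroupᵇ H)
                  (H∩Z≡1 : ∀ h → H h ≡ true → Zᵇ h ≡ true → h ≡ ε) where

    centraliser : Fin order → Bool
    centraliser g = does (all? λ h → (H h ≟ᵇ true) →-dec ([ h , g ] ≟ ε))

    -- Commuting pairs (h, g) ∈ H × G, counted for fixed g: all of H commutes
    -- with g ∈ C(H); otherwise the centraliser of g in H has index p.
    pairs-over-g : ∀ g → p * count (λ h → H h ∧ commutes h g) ≡ count H + bit (centraliser g) * (q * count H)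
    pairs-over-g g with centraliser g in Cg
    ... | true = begin
      p * count (λ h → H h ∧ commutes h g) ≡⟨ cong (p *_) (count-cong ∧-commutes) ⟩
      p * count H                          ≡⟨ cong (_* count H) p≡1+q ⟩
      count H + q * count H                ≡⟨ cong (count H +_) (+-identityʳ (q * count H)) ⟨
      count H + 1 * (q * count H)          ∎
      where
      open ≡-Reasoning
      all-commute : ∀ h → H h ≡ true → [ h , g ] ≡ ε
      all-commute = does-sound (all? _) Cg
      ∧-commutes : ∀ h → (H h ∧ commutes h g) ≡ H h
      ∧-commutes h with H h in Hh
      ... | true  = dec-true ([ h , g ] ≟ ε) (all-commute h Hh)
      ... | false = refl
    ... | false with ¬∀⟶∃¬ order _ (λ h → (H h ≟ᵇ true) →-dec ([ h , g ] ≟ ε)) (does-false (all? _) Cg)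
    ...   | h , ¬commute with ¬-implication (H h ≟ᵇ true) ¬commute
    ...     | Hh , nontrivial = begin
      p * count (λ h → H h ∧ commutes h g) ≡⟨ *-comm p _ ⟩
      count (λ h → H h ∧ commutes h g) * p ≡⟨ centraliser-index sH g h Hh nontrivial ⟨
      count H                              ≡⟨ +-identityʳ (count H) ⟨
      count H + 0                          ∎
      where open ≡-Reasoning

    -- Counted for fixed h ∈ H: ε commutes with everything, and every other
    -- h ∈ H is noncentral, so its centraliser has index p in G.
    pairs-over-h : ∀ h → p * count (λ g → H h ∧ commutes h g) ≡ bit (H h) * order + bit (h == ε) * (q * order)
    pairs-over-h h with H h in Hh | h ≟ ε
    ... | false | yes refl = contradiction (trans (sym Hh) (ε∈ sH)) false≢true
    ... | false | no h≢ε = trans (cong (p *_) (count-none {order} (λ _ → false) (λ _ → refl))) (*-zeroʳ p)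
    ... | true | yes refl = begin
      p * count (commutes ε)    ≡⟨ cong (p *_) (trans (count-cong commutes-ε) count-full) ⟩
      p * order                 ≡⟨ cong (_* order) p≡1+q ⟩
      order + q * order         ≡⟨ cong₂ _+_ (+-identityʳ order) (+-identityʳ (q * order)) ⟨
      (order + 0) + (q * order + 0) ∎
      where open ≡-Reasoning
    ... | true | no h≢ε = begin
      p * count (commutes h)              ≡⟨ cong (p *_) (count-cong (commutes-sym h)) ⟩
      p * count (λ g → commutes g h)      ≡⟨ *-comm p _ ⟩
      count (λ g → commutes g h) * p      ≡⟨ centraliser-index whole-subgroup h y refl y-h-nontrivial ⟨
      count {order} (λ _ → true)          ≡⟨ count-full ⟩
      order                               ≡⟨ +-identityʳ order ⟨
      order + 0                           ≡⟨ +-identityʳ (order + 0) ⟨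
      (order + 0) + 0                     ∎
      where
      open ≡-Reasoning
      h∉Z : Zᵇ h ≡ false
      h∉Z = ¬-not (λ Zh → h≢ε (H∩Z≡1 h Hh Zh))
      y : Fin order
      y = proj₁ (noncentral-witness h h∉Z)
      y-h-nontrivial : [ y , h ] ≢ ε
      y-h-nontrivial e = proj₂ (noncentral-witness h h∉Z) (sym (commutator-trivial⇒commute y h e))

    commuting-pairs : ℕ
    commuting-pairs = sum {order} (λ g → count (λ h → H h ∧ commutes h g))

    commuting-pairs-by-g : p * commuting-pairs ≡ order * count H + count centraliser * (q * count H)
    commuting-pairs-by-g = begin
      p * commuting-pairs                                        ≡⟨ *-distribˡ-sum {order} p _ ⟩
      sum (λ g → p * count (λ h → H h ∧ commutes h g))           ≡⟨ sum-cong-≗ pairs-over-g ⟩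
      sum (λ g → count H + bit (centraliser g) * (q * count H))  ≡⟨ ∑-distrib-+ {order} (λ _ → count H) _ ⟩
      sum {order} (λ _ → count H) + sum (λ g → bit (centraliser g) * (q * count H))
        ≡⟨ cong₂ _+_ (sum-const {order} (count H)) (count-scale centraliser (q * count H)) ⟩
      order * count H + count centraliser * (q * count H)        ∎
      where open ≡-Reasoning

    commuting-pairs-by-h : p * commuting-pairs ≡ count H * order + q * order
    commuting-pairs-by-h = begin
      p * commuting-pairs                                          ≡⟨ cong (p *_) (∑-comm {order} {order} (λ g h → bit (H h ∧ commutes h g))) ⟩
      p * sum (λ h → count (λ g → H h ∧ commutes h g))             ≡⟨ *-distribˡ-sum {order} p _ ⟩
      sum (λ h → p * count (λ g → H h ∧ commutes h g))             ≡⟨ sum-cong-≗ pairs-over-h ⟩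
      sum (λ h → bit (H h) * order + bit (h == ε) * (q * order))   ≡⟨ ∑-distrib-+ {order} (λ h → bit (H h) * order) _ ⟩
      sum (λ h → bit (H h) * order) + sum (λ h → bit (h == ε) * (q * order))
        ≡⟨ cong₂ _+_ (count-scale H order) (count-scale (_== ε) (q * order)) ⟩
      count H * order + count (_== ε) * (q * order)               ≡⟨ cong (λ c → count H * order + c * (q * order)) (count-single ε) ⟩
      count H * order + 1 * (q * order)                           ≡⟨ cong (count H * order +_) (+-identityʳ (q * order)) ⟩
      count H * order + q * order                                 ∎
      where open ≡-Reasoning

    centraliser-count : count centraliser * count H ≡ order
    centraliser-count = *-cancelˡ-≡ _ _ q {{>-nonZero 1≤q}} (begin
      q * (count centraliser * count H) ≡⟨ q-shuffle ⟩
      count centraliser * (q * count H) ≡⟨ +-cancelˡ-≡ (order * count H) _ _ (trans (sym commuting-pairs-by-g)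
                                             (trans commuting-pairs-by-h (cong (_+ q * order) (*-comm (count H) order)))) ⟩
      q * order                         ∎)
      where
      open ≡-Reasoning
      q-shuffle : q * (count centraliser * count H) ≡ count centraliser * (q * count H)
      q-shuffle = trans (sym (*-assoc q (count centraliser) (count H)))
        (trans (cong (_* count H) (*-comm q (count centraliser))) (*-assoc (count centraliser) q (count H)))

    -- An abelian H lies in its own centraliser, so |H|² ≤ |G|.
    abelian-square-bound : (∀ a b → H a ≡ true → H b ≡ true → [ a , b ] ≡ ε) → count H * count H ≤ order
    abelian-square-bound abelian =
      ≤-trans (*-monoˡ-≤ (count H) (count-mono H centraliser H⊆C)) (≤-reflexive centraliser-count)
      where
      H⊆C : ∀ h → H h ≡ true → centraliser h ≡ true
      H⊆C h Hh = dec-true (all? _) (λ h′ Hh′ → abelian h′ h Hh′ Hh)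

  -- A subgroup H missing some central element meets Z trivially (|Z| = p) and
  -- is abelian (H' ⊆ H ∩ G' ⊆ H ∩ Z); hence |H|² ≤ |G|.
  avoiding-central-element : ∀ {H} → IsSubgroupᵇ H → ∀ z → Zᵇ z ≡ true → H z ≡ false →
    count H * count H ≤ order
  avoiding-central-element {H} sH z Zz Hz = CoreFree.abelian-square-bound sH H∩Z≡1 abelian
    where
    H∩Z : Fin order → Bool
    H∩Z y = H y ∧ Zᵇ y
    H∩Z⊆Z : ∀ y → H∩Z y ≡ true → Zᵇ y ≡ true
    H∩Z⊆Z y = ∧-true₂ {H y}
    H∩Z≡1 : ∀ h → H h ≡ true → Zᵇ h ≡ true → h ≡ ε
    H∩Z≡1 h Hh Zh with subgroup-of-prime-order pr centre-subgroup (∩-subgroup sH centre-subgroup) H∩Z⊆Z count-Z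
    ... | inj₁ trivial = trivial h (∧-intro Hh Zh)
    ... | inj₂ size = contradiction (trans (sym Hz) (∧-true₁ (count-⊆-eq H∩Z Zᵇ H∩Z⊆Z
                                      (≤-reflexive (trans count-Z (sym size))) z Zz))) false≢true
    abelian : ∀ a b → H a ≡ true → H b ≡ true → [ a , b ] ≡ ε
    abelian a b Ha Hb = H∩Z≡1 [ a , b ] (∙∈ sH (∙∈ sH (⁻¹∈ sH Ha) (⁻¹∈ sH Hb)) (∙∈ sH Ha Hb))
                                        (central⇒∈ (commutators-central a b))

p^[2m+1]≡p^m*p^[m+1] : ∀ p m → p ^ (2 * m + 1) ≡ p ^ m * p ^ suc m
p^[2m+1]≡p^m*p^[m+1] p m = trans (cong (p ^_) exponent) (^-distribˡ-+-* p m (suc m))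
  where
  exponent : 2 * m + 1 ≡ m + suc m
  exponent = trans (cong (λ t → m + t + 1) (+-identityʳ m)) (trans (+-assoc m m 1) (cong (m +_) (+-comm m 1)))

-- Arithmetic: if c² ≤ n = p^(2m+1) then n / c ≥ p^m, since otherwise
-- n < p^m · c forces c > p^(m+1), and then c² > p^m · p^(m+1) = n.
quotient-lower-bound : ∀ {p} m → Prime p → ∀ n c .{{_ : NonZero c}} →
  n ≡ p ^ (2 * m + 1) → c * c ≤ n → p ^ m ≤ n / c
quotient-lower-bound {p} m pr n c n≡ square with p ^ m * c ≤? n
... | yes large = ≤-trans (≤-reflexive (sym (m*n/n≡m (p ^ m) c))) (/-monoˡ-≤ c large)
... | no small = contradiction square (<⇒≱ n<c*c)
  where
  instance _ = prime⇒nonZero pr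
  n≡ab : n ≡ p ^ m * p ^ suc m
  n≡ab = trans n≡ (p^[2m+1]≡p^m*p^[m+1] p m)
  p^[m+1]<c : p ^ suc m < c
  p^[m+1]<c = *-cancelˡ-< (p ^ m) _ _ (subst (_< p ^ m * c) n≡ab (≰⇒> small))
  n<c*c : n < c * c
  n<c*c = begin-strict
    n                     ≡⟨ n≡ab ⟩
    p ^ m * p ^ suc m     ≤⟨ *-monoˡ-≤ (p ^ suc m) (^-monoʳ-≤ p (n≤1+n m)) ⟩
    p ^ suc m * p ^ suc m <⟨ *-mono-< p^[m+1]<c p^[m+1]<c ⟩
    c * c                 ∎
    where open ≤-Reasoning

index-lower-bound : ∀ (G : FinGroup) {p} m → Prime p → FinGroup.order G ≡ p ^ (2 * m + 1) →
  ∀ (H : Subset (FinGroup.order G)) → 1 ≤ ∣ H ∣ → ∣ H ∣ * ∣ H ∣ ≤ FinGroup.order G → p ^ m ≤ index G H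
index-lower-bound G m pr |G| H 1≤|H| square with ∣ H ∣
... | suc c = quotient-lower-bound m pr (FinGroup.order G) (suc c) |G| square

proposition2p5 : (p m : ℕ) → Prime p → 1 ≤ m → (G : FinGroup)
    → FinGroup.order G ≡ p ^ (2 * m + 1) → IsExtraspecial G p
    → Σ (Fin (FinGroup.order G)) (λ x → (x ≢ FinGroup.ε G)
        × (∀ (H : Subset (FinGroup.order G)) → IsSubgroup G H → index G H < p ^ m → x ∈ H))
proposition2p5 p m pr _ G |G| (_ , (Z , isZ , |Z|) , (D , isD , |D|)) = z , z≢ε , z∈H
  where
  open FinGroup G using (order; ε)
  open GroupTheory G using (subgroupᵇ; ε∈)
  open Extraspecial G pr {k = 2 * m + 1} |G| isZ |Z| isD |D| using (Zᵇ; count-Z; avoiding-central-element)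

  -- |Z| = p ≥ 2, so Z contains some z ≠ ε.
  nontrivial-central : ∃ λ z → Zᵇ z ≡ true × z ≢ ε
  nontrivial-central = count-another Zᵇ (subst (2 ≤_) (sym count-Z) (nonTrivial⇒n>1 p {{prime⇒nonTrivial pr}})) ε

  z : Fin order
  z = proj₁ nontrivial-central

  z≢ε : z ≢ ε
  z≢ε = proj₂ (proj₂ nontrivial-central)

  -- A subgroup missing z has |H|² ≤ |G|, hence index at least p^m.
  z∈H : ∀ (H : Subset order) → IsSubgroup G H → index G H < p ^ m → z ∈ H
  z∈H H isH small with lookup H z in Hz
  ... | true  = lookup⇒[]= z H Hz
  ... | false = contradiction (index-lower-bound G m pr |G| H 1≤|H| square) (<⇒≱ small)
    where
    |H|≡ : ∣ H ∣ ≡ count (lookup H)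
    |H|≡ = subset-count H
    1≤|H| : 1 ≤ ∣ H ∣
    1≤|H| = subst (1 ≤_) (sym |H|≡) (count-pos (lookup H) ε (ε∈ (subgroupᵇ isH)))
    square : ∣ H ∣ * ∣ H ∣ ≤ order
    square = subst (λ c → c * c ≤ order) (sym |H|≡)
      (avoiding-central-element (subgroupᵇ isH) z (proj₁ (proj₂ nontrivial-central)) Hz)
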